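{- Let $D$ be a digraph with a nice fuzzy linear interval model $(f,\mathcal I)$, with the notation of the context. If $x\prec y$ are non-adjacent vertices and $\{x,y\}$ does not absorb $[x;y]$, then \[ K(x,y)=\bigsqcup_{m\in(\delta(y)\setminus N(\{x,y\}))\sqcup\{\emptyset\}} K_0(x,m,y), \] \[ K_0(x,\emptyset,y)=\bigsqcup_{w\in\Lambda(x,y)}\{k\sqcup\{y\} : k\in K(x,w)\}, \] and for every $m\in\delta(y)\setminus N(\{x,y\})$, \[ K_0(x,m,y)=\begin{cases}\{\{x,m,y\}\} & \text{if } \{x,m,y\}\text{ absorbs }[x;y],\\ \bigsqcup_{w\in\Lambda'(x,m,y)}\{k\sqcup\{m,y\} : k\in K(x,w)\} & \text{otherwise}.\end{cases} \] Finally, if $x\prec y$ are non-adjacent and $\{x,y\}$ absorbs $[x;y]$, then $K(x,y)=\{\{x,y\}\}$.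
   Context: A digraph is a simple, loopless, finite graph with each edge oriented in one or both directions; two vertices are adjacent if joined by an edge in either direction. $N(x)$ is the set of vertices adjacent to $x$ and $N(S)=\bigcup_{x\in S}N(x)$; $N^-(x)$ is the set of in-neighbours of $x$ and $N^-(A)=\bigcup_{x\in A}N^-(x)$. A set $A$ absorbs a set $B$ if $B\subset A\cup N^-(A)$. A kernel is an independent set $k$ with $N^-(k)$ equal to the complement of $k$. $D[S]$ is the induced subdigraph on $S$. $\sqcup$ denotes a union of pairwise disjoint sets. A fuzzy linear interval model of (the underlying graph of) $D$ is a pair $(f,\mathcal I)$ where $f\colon V(D)\to[0,1]$ and $\mathcal I$ is a set of closed intervals $[a,b]\subset[0,1]$ with $a<b$ such that: (1) no two intervals of $\mathcal I$ share an endpoint; (2) no proper inclusions among members of $\mathcal I$; (3) for every two adjacent vertices $x,y$ there is $I\in\mathcal I$ with $f(x),f(y)\in I$; (4) for every two non-adjacent vertices $x,y$ and every $I\in\mathcal I$, if $f(x),f(y)\in I$ then the endpoints of $I$ are $f(x)$ and $f(y)$. It is nice if $|\mathcal I|\le|V(D)|$ and distinct vertices with equal $f$-value are adjacent. $x\prec y$ iff $f(x)<f(y)$; $x\preceq y$ iff $f(x)\le f(y)$. Vertex intervals: $[x;y]=\{z:x\preceq z\preceq y\}$, $(x;y)=\{z:x\prec z\prec y\}$, $(x;y]=\{z:x\prec z\preceq y\}$, etc. For a vertex $x$: if some interval of $\mathcal I$ has the form $[a,f(x)]$ (there is at most one), $\delta(x)=f^{ -1}(a)$; otherwise $\delta(x)=\emptyset$.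 For vertices $x,y$, $K(x,y)=\{k\in\ker D[[x;y]] : x,y\in k\}$, $K_0(x,\emptyset,y)=\{k\in K(x,y): k\cap\delta(y)=\emptyset\}$ and, for $m\in\delta(y)$, $K_0(x,m,y)=\{k\in K(x,y): m\in k\}$. For $x\prec y$, $\Lambda(x,y)=\{m\in(x;y)\setminus(N(\{x,y\})\cup\delta(y)) : \{m,y\}\text{ absorbs }(m;y]\}$, and for $m\in\delta(y)\setminus N(\{x,y\})$, $\Lambda'(x,m,y)=\{w\in(x;m)\setminus N(\{x,m\}) : \{w,m,y\}\text{ absorbs }(w;y]\}$.
   Formalization: The function f and the endpoints of the intervals in $\mathcal I$ take values in ℚ ∩ [0,1] instead of the real interval [0,1]. -}

module Defs where

open import Data.Nat using (ℕ)
open import Data.Bool using (Bool; true; false)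
open import Data.Fin using (Fin)
open import Data.Fin.Subset using (Subset; _∪_; ⁅_⁆) renaming (_∈_ to _∈ₛ_; _∉_ to _∉ₛ_)
open import Data.Rational using (ℚ; _≤_; _<_; 0ℚ; 1ℚ)
open import Data.List using (List; length)
open import Data.List.Membership.Propositional using () renaming (_∈_ to _∈ₗ_)
open import Data.List.Relation.Unary.Unique.Propositional using (Unique)
open import Data.Product using (Σ; ∃; ∃-syntax; _×_; _,_; proj₁; proj₂)
open import Data.Sum using (_⊎_)
open import Relation.Nullary using (¬_)
open import Relation.Binary.PropositionalEquality using (_≡_; _≢_)

-- Digraphs on the vertex set Fin n.
-- arc u v ≡ true  means there is an edge oriented from u to v.
-- An edge oriented in both directions has arc u v ≡ arc v u ≡ true.

record Digraph (n : ℕ) : Set where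
  field
    arc      : Fin n → Fin n → Bool
    loopless : ∀ u → arc u u ≡ false

module _ {n : ℕ} (D : Digraph n) where
  open Digraph D

  Arc : Fin n → Fin n → Set
  Arc u v = arc u v ≡ true

  Adj : Fin n → Fin n → Set
  Adj u v = Arc u v ⊎ Arc v u

  Absorbs : (Fin n → Set) → (Fin n → Set) → Set
  Absorbs A B = ∀ z → B z → A z ⊎ (∃[ u ] (A u × Arc z u))

  IsKernelOf : (Fin n → Set) → Subset n → Set
  IsKernelOf S k =
      (∀ u → u ∈ₛ k → S u)
    × (∀ u v → u ∈ₛ k → v ∈ₛ k → ¬ Adj u v)
    × (∀ z → S z → z ∉ₛ k → ∃[ u ] (u ∈ₛ k × Arc z u))

Interval : Set
Interval = ℚ × ℚ

_∈ᵢ_ : ℚ → Interval → Set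
t ∈ᵢ I = proj₁ I ≤ t × t ≤ proj₂ I

module _ {n : ℕ} (D : Digraph n) where

  record IsFuzzyLinearIntervalModel (f : Fin n → ℚ) (𝓘 : List Interval) : Set where
    field
      f-range    : ∀ x → 0ℚ ≤ f x × f x ≤ 1ℚ
      𝓘-range    : ∀ I → I ∈ₗ 𝓘 → 0ℚ ≤ proj₁ I × proj₁ I < proj₂ I × proj₂ I ≤ 1ℚ
      noShare    : ∀ I J → I ∈ₗ 𝓘 → J ∈ₗ 𝓘 → I ≢ J →
                     (proj₁ I ≢ proj₁ J) × (proj₁ I ≢ proj₂ J)
                   × (proj₂ I ≢ proj₁ J) × (proj₂ I ≢ proj₂ J)
      noIncl     : ∀ I J → I ∈ₗ 𝓘 → J ∈ₗ 𝓘 →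
                     proj₁ J ≤ proj₁ I → proj₂ I ≤ proj₂ J → I ≡ J
      adjCovered : ∀ x y → Adj D x y → ∃[ I ] (I ∈ₗ 𝓘 × f x ∈ᵢ I × f y ∈ᵢ I)
      nonAdj     : ∀ x y → x ≢ y → ¬ Adj D x y → ∀ I → I ∈ₗ 𝓘 →
                     f x ∈ᵢ I → f y ∈ᵢ I →
                     (f x ≡ proj₁ I × f y ≡ proj₂ I) ⊎ (f x ≡ proj₂ I × f y ≡ proj₁ I)

  -- nice: |𝓘| ≤ |V(D)| (𝓘 is a set, so the list is duplicate-free),
  -- and distinct vertices with equal f-value are adjacent
  record IsNiceModel (f : Fin n → ℚ) (𝓘 : List Interval) : Set where
    field
      model    : IsFuzzyLinearIntervalModel f 𝓘
      unique   : Unique 𝓘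
      size     : length 𝓘 Data.Nat.≤ n
      sameVal  : ∀ x y → x ≢ y → f x ≡ f y → Adj D x y

module Notation {n : ℕ} (D : Digraph n) (f : Fin n → ℚ) (𝓘 : List Interval) where

  _≺_ : Fin n → Fin n → Set
  x ≺ y = f x < f y

  Icc : Fin n → Fin n → Fin n → Set
  Icc x y z = f x ≤ f z × f z ≤ f y

  Ioo : Fin n → Fin n → Fin n → Set
  Ioo x y z = f x < f z × f z < f y

  Ioc : Fin n → Fin n → Fin n → Set
  Ioc x y z = f x < f z × f z ≤ f y

  δ : Fin n → Fin n → Set
  δ y m = ∃[ I ] (I ∈ₗ 𝓘 × proj₂ I ≡ f y × f m ≡ proj₁ I)

  N₂ : Fin n → Fin n → Fin n → Set
  N₂ x y z = Adj D z x ⊎ Adj D z y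

  set2 : Fin n → Fin n → Fin n → Set
  set2 a b z = z ≡ a ⊎ z ≡ b

  set3 : Fin n → Fin n → Fin n → Fin n → Set
  set3 a b c z = z ≡ a ⊎ z ≡ b ⊎ z ≡ c

  K : Fin n → Fin n → Subset n → Set
  K x y k = IsKernelOf D (Icc x y) k × x ∈ₛ k × y ∈ₛ k

  K₀∅ : Fin n → Fin n → Subset n → Set
  K₀∅ x y k = K x y k × (∀ m → δ y m → m ∉ₛ k)

  K₀ : Fin n → Fin n → Fin n → Subset n → Set
  K₀ x m y k = K x y k × m ∈ₛ k

  M : Fin n → Fin n → Fin n → Set
  M x y m = δ y m × ¬ N₂ x y m

  Λ : Fin n → Fin n → Fin n → Set
  Λ x y m = Ioo x y m × ¬ N₂ x y m × ¬ δ y m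
          × Absorbs D (set2 m y) (Ioc m y)

  Λ' : Fin n → Fin n → Fin n → Fin n → Set
  Λ' x m y w = Ioo x m w × ¬ N₂ x m w
             × Absorbs D (set3 w m y) (Ioc w y)

{-# OPTIONS --safe #-}
-- The geometric input is that no edge of D can strictly span a non-edge: if p ~ q, b ≁ c and
-- f p ≤ f b < f c ≤ f q, then the interval of 𝓘 covering p q is exactly [f b , f c].
-- Consequently a kernel k of D[[x;y]] is cut at a vertex w ∈ k into a kernel of D[[x;w]]
-- and the part of k above w, which together with w absorbs (w;y], provided 𝓘 contains no
-- interval [f w , f t] with t ∈ k above w; conversely such pieces glue back as soon as no
-- edge joins them.  Taking for w the highest vertex of k below y (resp. below m ∈ δ(y)),
-- so that the top part is {y} (resp. {m , y}), gives both decompositions; w is recovered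
-- from the glued kernel as its highest vertex outside the top part, so the unions are disjoint.
module Submission where

open import Defs
open import Data.Nat using (ℕ; zero; suc)
open import Data.Fin using (Fin; zero; suc)
open import Data.Fin.Properties using (any?) renaming (_≟_ to _≟ᶠ_)
open import Data.Fin.Subset using (Subset; _∪_; _∩_; ∁; ⁅_⁆; _∈_; _∉_; _⊆_)
open import Data.Fin.Subset.Properties
  using (x∈⁅x⁆; x∈⁅y⁆⇒x≡y; x∈p∪q⁺; x∈p∪q⁻; x∈p∩q⁺; x∈p∩q⁻; x∉p⇒x∈∁p; x∈∁p⇒x∉p; ⊆-antisym; _∈?_)
open import Data.List using (List)
open import Data.List.Membership.Propositional using (find) renaming (_∈_ to _∈ₗ_)
open import Data.List.Membership.Propositional.Properties.Core using (∃∈-Any)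
open import Data.List.Relation.Unary.Any using () renaming (any? to anyₗ?)
open import Data.Product using (_×_; ∃-syntax; _,_; proj₁; proj₂)
import Data.Product as Product
open import Data.Sum using (_⊎_; inj₁; inj₂; [_,_]; reduce)
import Data.Sum as Sum
open import Data.Rational using (ℚ; _≤_; _<_)
import Data.Rational.Properties as ℚ
open import Function using (_∘_; id)
open import Function.Bundles using (_⇔_; mk⇔; Equivalence)
open import Function.Properties.Equivalence using () renaming (trans to ⇔-trans)
open import Relation.Binary.PropositionalEquality using (_≡_; _≢_; refl; sym; trans; cong; subst; subst₂)
open import Relation.Nullary using (¬_; Dec; yes; no; contradiction)
open import Relation.Nullary.Decidable using (_×-dec_; map′)

open Equivalence using (to; from)

<⇒≱ : ∀ {p q : ℚ} → p < q → ¬ q ≤ p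
<⇒≱ p<q q≤p = ℚ.<-irrefl refl (ℚ.<-≤-trans p<q q≤p)

≤∧≢⇒< : ∀ {p q : ℚ} → p ≤ q → p ≢ q → p < q
≤∧≢⇒< {p} {q} p≤q p≢q with p ℚ.<? q
... | yes p<q = p<q
... | no p≮q = contradiction (ℚ.≤-antisym p≤q (ℚ.≮⇒≥ p≮q)) p≢q

argmax : ∀ {n} (g : Fin n → ℚ) {P : Fin n → Set} → (∀ u → Dec (P u)) →
         (∀ u → ¬ P u) ⊎ ∃[ w ] (P w × (∀ u → P u → g u ≤ g w))
argmax {zero}  g P? = inj₁ λ ()
argmax {suc n} g P? with argmax (g ∘ suc) (P? ∘ suc) | P? zero
... | inj₁ none | no ¬p₀ = inj₁ λ { zero → ¬p₀ ; (suc u) → none u }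
... | inj₁ none | yes p₀ =
  inj₂ (zero , p₀ , λ { zero _ → ℚ.≤-refl ; (suc u) p → contradiction p (none u) })
... | inj₂ (w , p , max) | no ¬p₀ =
  inj₂ (suc w , p , λ { zero p₀ → contradiction p₀ ¬p₀ ; (suc u) → max u })
... | inj₂ (w , p , max) | yes p₀ with g zero ℚ.≤? g (suc w)
...   | yes g₀≤ = inj₂ (suc w , p , λ { zero _ → g₀≤ ; (suc u) → max u })
...   | no g₀≰ = inj₂ (zero , p₀ , λ { zero _ → ℚ.≤-refl
                                     ; (suc u) q → ℚ.≤-trans (max u q) (ℚ.<⇒≤ (ℚ.≰⇒> g₀≰)) })

module _ {n : ℕ} where

  ≡⇒∈⁅⁆ : ∀ {u a : Fin n} → u ≡ a → u ∈ ⁅ a ⁆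
  ≡⇒∈⁅⁆ refl = x∈⁅x⁆ _

  ∈-pair⁻ : ∀ {a b u : Fin n} → u ∈ ⁅ a ⁆ ∪ ⁅ b ⁆ → u ≡ a ⊎ u ≡ b
  ∈-pair⁻ {a} {b} = Sum.map (x∈⁅y⁆⇒x≡y a) (x∈⁅y⁆⇒x≡y b) ∘ x∈p∪q⁻ ⁅ a ⁆ ⁅ b ⁆

  ∈-pair⁺ : ∀ {a b u : Fin n} → u ≡ a ⊎ u ≡ b → u ∈ ⁅ a ⁆ ∪ ⁅ b ⁆
  ∈-pair⁺ = x∈p∪q⁺ ∘ Sum.map ≡⇒∈⁅⁆ ≡⇒∈⁅⁆

  ∈-triple⁻ : ∀ {a b c u : Fin n} → u ∈ ⁅ a ⁆ ∪ (⁅ b ⁆ ∪ ⁅ c ⁆) → u ≡ a ⊎ u ≡ b ⊎ u ≡ c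
  ∈-triple⁻ {a} {b} {c} = Sum.map (x∈⁅y⁆⇒x≡y a) ∈-pair⁻ ∘ x∈p∪q⁻ ⁅ a ⁆ (⁅ b ⁆ ∪ ⁅ c ⁆)

  ∈-triple⁺ : ∀ {a b c u : Fin n} → u ≡ a ⊎ u ≡ b ⊎ u ≡ c → u ∈ ⁅ a ⁆ ∪ (⁅ b ⁆ ∪ ⁅ c ⁆)
  ∈-triple⁺ = x∈p∪q⁺ ∘ Sum.map ≡⇒∈⁅⁆ ∈-pair⁺

  ⁅⁆⊆ : ∀ {a : Fin n} {k} → a ∈ k → ⁅ a ⁆ ⊆ k
  ⁅⁆⊆ {a} a∈k u∈ rewrite x∈⁅y⁆⇒x≡y a u∈ = a∈k

  ∪⊆ : ∀ {p q r : Subset n} → p ⊆ r → q ⊆ r → p ∪ q ⊆ r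
  ∪⊆ {p} {q} p⊆r q⊆r u∈ = [ p⊆r , q⊆r ] (x∈p∪q⁻ p q u∈)

  ∈-∪-cancelʳ : ∀ {p q r : Subset n} {u} → u ∉ r → u ∈ p → p ∪ r ≡ q ∪ r → u ∈ q
  ∈-∪-cancelʳ {q = q} {r} u∉r u∈p eq with x∈p∪q⁻ q r (subst (_ ∈_) eq (x∈p∪q⁺ (inj₁ u∈p)))
  ... | inj₁ u∈q = u∈q
  ... | inj₂ u∈r = contradiction u∈r u∉r

  p∩∁q∪q≡p : ∀ {p q : Subset n} → q ⊆ p → (p ∩ ∁ q) ∪ q ≡ p
  p∩∁q∪q≡p {p} {q} q⊆p = ⊆-antisym ⊆p p⊆
    where
    ⊆p : (p ∩ ∁ q) ∪ q ⊆ p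
    ⊆p u∈ = [ proj₁ ∘ x∈p∩q⁻ p (∁ q) , q⊆p ] (x∈p∪q⁻ (p ∩ ∁ q) q u∈)
    p⊆ : p ⊆ (p ∩ ∁ q) ∪ q
    p⊆ {u} u∈p with u ∈? q
    ... | yes u∈q = x∈p∪q⁺ (inj₂ u∈q)
    ... | no u∉q = x∈p∪q⁺ (inj₁ (x∈p∩q⁺ (u∈p , x∉p⇒x∈∁p u∉q)))

module Kernels {n : ℕ} (D : Digraph n) where
  open Digraph D

  Independent : Subset n → Set
  Independent k = ∀ u v → u ∈ k → v ∈ k → ¬ Adj D u v

  Adj-sym : ∀ {u v} → Adj D u v → Adj D v u
  Adj-sym = Sum.swap

  Adj-irrefl : ∀ u → ¬ Adj D u u
  Adj-irrefl u u~u with () ← trans (sym (reduce u~u)) (loopless u)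

  Independent-⁅⁆ : ∀ a → Independent ⁅ a ⁆
  Independent-⁅⁆ a u v u∈ v∈ rewrite x∈⁅y⁆⇒x≡y a u∈ | x∈⁅y⁆⇒x≡y a v∈ = Adj-irrefl a

  Independent-∪ : ∀ {p q} → Independent p → Independent q →
                  (∀ u v → u ∈ p → v ∈ q → ¬ Adj D u v) → Independent (p ∪ q)
  Independent-∪ {p} {q} ind-p ind-q apart u v u∈ v∈ with x∈p∪q⁻ p q u∈ | x∈p∪q⁻ p q v∈
  ... | inj₁ u∈p | inj₁ v∈p = ind-p u v u∈p v∈p
  ... | inj₁ u∈p | inj₂ v∈q = apart u v u∈p v∈q
  ... | inj₂ u∈q | inj₁ v∈p = apart v u v∈p u∈q ∘ Adj-sym
  ... | inj₂ u∈q | inj₂ v∈q = ind-q u v u∈q v∈q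

  Independent-pair : ∀ {a b} → ¬ Adj D a b → Independent (⁅ a ⁆ ∪ ⁅ b ⁆)
  Independent-pair {a} {b} a≁b = Independent-∪ (Independent-⁅⁆ a) (Independent-⁅⁆ b) apart
    where
    apart : ∀ u v → u ∈ ⁅ a ⁆ → v ∈ ⁅ b ⁆ → ¬ Adj D u v
    apart u v u∈ v∈ rewrite x∈⁅y⁆⇒x≡y a u∈ | x∈⁅y⁆⇒x≡y b v∈ = a≁b

  Absorbs-mono : ∀ {A A′ B : Fin n → Set} → (∀ {z} → A z → A′ z) →
                 Absorbs D A B → Absorbs D A′ B
  Absorbs-mono A⊆A′ ab z z∈B = Sum.map A⊆A′ (Product.map₂ (Product.map₁ A⊆A′)) (ab z z∈B)

  kernel-absorbs : ∀ {S k} → IsKernelOf D S k → Absorbs D (_∈ k) S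
  kernel-absorbs {k = k} (_ , _ , ab) z z∈S with z ∈? k
  ... | yes z∈k = inj₁ z∈k
  ... | no z∉k = inj₂ (ab z z∈S z∉k)

  kernel-unique-if-absorbing : ∀ {S A} → (∀ u → u ∈ A → S u) → Independent A →
                               Absorbs D (_∈ A) S →
                               ∀ k → (IsKernelOf D S k × A ⊆ k) ⇔ (k ≡ A)
  kernel-unique-if-absorbing {S} {A} A⊆S ind-A ab k = mk⇔ unique (λ { refl → kernel-A , id })
    where
    kernel-A : IsKernelOf D S A
    kernel-A = A⊆S , ind-A , λ z z∈S z∉A → [ (λ z∈A → contradiction z∈A z∉A) , id ] (ab z z∈S)
    unique : IsKernelOf D S k × A ⊆ k → k ≡ A
    unique ((k⊆S , ind , _) , A⊆k) = ⊆-antisym k⊆A A⊆k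
      where
      k⊆A : k ⊆ A
      k⊆A {u} u∈k with ab u (k⊆S u u∈k)
      ... | inj₁ u∈A = u∈A
      ... | inj₂ (v , v∈A , u→v) = contradiction (inj₁ u→v) (ind u v u∈k (A⊆k v∈A))

module NiceModel {n : ℕ} {D : Digraph n} {f : Fin n → ℚ} {𝓘 : List Interval}
                 (nice : IsNiceModel D f 𝓘) where
  open IsNiceModel nice
  open IsFuzzyLinearIntervalModel model
  open Notation D f 𝓘
  open Kernels D

  IsSlice : Subset n → (Fin n → Set) → Subset n → Set
  IsSlice k P T = ∀ u → u ∈ T ⇔ (u ∈ k × P u)

  ≺⇒≢ : ∀ {u v} → u ≺ v → u ≢ v
  ≺⇒≢ u≺v = ℚ.<⇒≢ u≺v ∘ cong f

  Independent-f-injective : ∀ {k u v} → Independent k → u ∈ k → v ∈ k → f u ≡ f v → u ≡ v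
  Independent-f-injective {u = u} {v} ind u∈k v∈k fu≡fv with u ≟ᶠ v
  ... | yes u≡v = u≡v
  ... | no u≢v = contradiction (sameVal u v u≢v fu≡fv) (ind u v u∈k v∈k)

  Independent-≤⇒≺ : ∀ {k u v} → Independent k → u ∈ k → v ∈ k → f u ≤ f v → u ≢ v → u ≺ v
  Independent-≤⇒≺ ind u∈k v∈k u≤v u≢v = ≤∧≢⇒< u≤v (u≢v ∘ Independent-f-injective ind u∈k v∈k)

  nonadjacent-in-interval : ∀ {I b c} → I ∈ₗ 𝓘 → ¬ Adj D b c → b ≺ c →
                            proj₁ I ≤ f b → f c ≤ proj₂ I → proj₁ I ≡ f b × proj₂ I ≡ f c
  nonadjacent-in-interval {I} {b} {c} I∈ b≁c b≺c I₁≤b c≤I₂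
    with nonAdj b c (≺⇒≢ b≺c) b≁c I I∈ (I₁≤b , ℚ.≤-trans (ℚ.<⇒≤ b≺c) c≤I₂)
                                       (ℚ.≤-trans I₁≤b (ℚ.<⇒≤ b≺c) , c≤I₂)
  ... | inj₁ (b≡I₁ , c≡I₂) = sym b≡I₁ , sym c≡I₂
  ... | inj₂ (b≡I₂ , _) = contradiction (ℚ.<-≤-trans b≺c c≤I₂) (ℚ.<-irrefl b≡I₂)

  edge-over-non-edge : ∀ {p q b c} → Adj D p q → ¬ Adj D b c → b ≺ c → f p ≤ f b → f c ≤ f q →
                       f p ≡ f b × f q ≡ f c × δ c b
  edge-over-non-edge {p} {q} p~q b≁c b≺c p≤b c≤q with adjCovered p q p~q
  ... | I , I∈ , (I₁≤p , _) , (_ , q≤I₂)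
    with nonadjacent-in-interval I∈ b≁c b≺c (ℚ.≤-trans I₁≤p p≤b) (ℚ.≤-trans c≤q q≤I₂)
  ... | I₁≡b , I₂≡c = ℚ.≤-antisym p≤b (subst (_≤ f p) I₁≡b I₁≤p)
                    , ℚ.≤-antisym (subst (f q ≤_) I₂≡c q≤I₂) c≤q
                    , (I , I∈ , I₂≡c , sym I₁≡b)

  δ⇒≺ : ∀ {y m} → δ y m → m ≺ y
  δ⇒≺ (I , I∈ , I₂≡y , m≡I₁) with 𝓘-range I I∈
  ... | _ , I₁<I₂ , _ = subst₂ _<_ (sym m≡I₁) I₂≡y I₁<I₂

  δ-resp-f : ∀ {y m w} → f m ≡ f w → δ y m → δ y w
  δ-resp-f m≈w (I , I∈ , I₂≡y , m≡I₁) = I , I∈ , I₂≡y , trans (sym m≈w) m≡I₁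

  δ? : ∀ y m → Dec (δ y m)
  δ? y m = map′ find ∃∈-Any (anyₗ? (λ I → (proj₂ I ℚ.≟ f y) ×-dec (f m ℚ.≟ proj₁ I)) 𝓘)

  δ-functional : ∀ {y m m′} → δ y m → δ y m′ → f m ≡ f m′
  δ-functional {m = m} {m′} (I , I∈ , I₂≡y , m≡I₁) (J , J∈ , J₂≡y , m′≡J₁) with f m ℚ.≟ f m′
  ... | yes m≈m′ = m≈m′
  ... | no m≉m′ = contradiction (trans I₂≡y (sym J₂≡y)) (proj₂ (proj₂ (proj₂ (noShare I J I∈ J∈ I≢J))))
    where
    I≢J : I ≢ J
    I≢J I≡J = m≉m′ (trans m≡I₁ (trans (cong proj₁ I≡J) (sym m′≡J₁)))

  δ-unchained : ∀ {y m w} → δ y m → ¬ δ m w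
  δ-unchained δm@(I , I∈ , I₂≡y , m≡I₁) (J , J∈ , J₂≡m , _) =
    proj₁ (proj₂ (proj₂ (noShare J I J∈ I∈ J≢I))) (trans J₂≡m m≡I₁)
    where
    J≢I : J ≢ I
    J≢I J≡I = ℚ.<-irrefl (trans (sym J₂≡m) (trans (cong proj₂ J≡I) I₂≡y)) (δ⇒≺ δm)

  non-neighbour-in-δ : ∀ {y m w} → δ y m → f m ≤ f w → w ≺ y → ¬ Adj D w y → f w ≡ f m
  non-neighbour-in-δ (I , I∈ , I₂≡y , m≡I₁) m≤w w≺y w≁y =
    sym (trans m≡I₁ (proj₁ (nonadjacent-in-interval I∈ w≁y w≺y
                              (subst (_≤ _) m≡I₁ m≤w) (ℚ.≤-reflexive (sym I₂≡y)))))

  δ-above-non-neighbour : ∀ {x y m} → δ y m → x ≺ y → ¬ Adj D x y → f x ≤ f m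
  δ-above-non-neighbour {x} {m = m} δm x≺y x≁y with ℚ.≤-total (f x) (f m)
  ... | inj₁ x≤m = x≤m
  ... | inj₂ m≤x = ℚ.≤-reflexive (non-neighbour-in-δ δm m≤x x≺y x≁y)

  slice-below : ∀ {w k T} → IsSlice k (w ≺_) T → ∀ u → u ∈ k ∩ ∁ T ⇔ (u ∈ k × f u ≤ f w)
  slice-below {w} {k} {T} T≐ u = mk⇔ below⁻ below⁺
    where
    below⁻ : u ∈ k ∩ ∁ T → u ∈ k × f u ≤ f w
    below⁻ u∈ with x∈p∩q⁻ k (∁ T) u∈
    ... | u∈k , u∈∁T = u∈k , ℚ.≮⇒≥ (λ w≺u → x∈∁p⇒x∉p u∈∁T (T≐ u .from (u∈k , w≺u)))
    below⁺ : u ∈ k × f u ≤ f w → u ∈ k ∩ ∁ T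
    below⁺ (u∈k , u≤w) = x∈p∩q⁺ (u∈k , x∉p⇒x∈∁p (λ u∈T → <⇒≱ (proj₂ (T≐ u .to u∈T)) u≤w))

  -- An arc from z ⪯ w to some t ≻ w in k would span the non-edge w t and put [f w , f t] into 𝓘.
  kernel-below : ∀ {x y w k T} → IsKernelOf D (Icc x y) k → w ∈ k → IsSlice k (w ≺_) T →
                 (∀ t → t ∈ T → ¬ δ t w) → IsKernelOf D (Icc x w) (k ∩ ∁ T)
  kernel-below {x} {w = w} {k} {T} (k⊆xy , ind , ab) w∈k T≐ T∌δ = sub , ind′ , ab′
    where
    below = slice-below T≐
    sub : ∀ u → u ∈ k ∩ ∁ T → Icc x w u
    sub u u∈ = proj₁ (k⊆xy u (proj₁ (below u .to u∈))) , proj₂ (below u .to u∈)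
    ind′ : Independent (k ∩ ∁ T)
    ind′ u v u∈ v∈ = ind u v (proj₁ (below u .to u∈)) (proj₁ (below v .to v∈))
    ab′ : ∀ z → Icc x w z → z ∉ k ∩ ∁ T → ∃[ u ] (u ∈ k ∩ ∁ T × Arc D z u)
    ab′ z (x≤z , z≤w) z∉
      with ab z (x≤z , ℚ.≤-trans z≤w (proj₂ (k⊆xy w w∈k))) (λ z∈k → z∉ (below z .from (z∈k , z≤w)))
    ... | u , u∈k , z→u with f w ℚ.<? f u
    ...   | no w⊀u = u , below u .from (u∈k , ℚ.≮⇒≥ w⊀u) , z→u
    ...   | yes w≺u = contradiction
      (proj₂ (proj₂ (edge-over-non-edge (inj₁ z→u) (ind w u w∈k u∈k) w≺u z≤w ℚ.≤-refl)))
      (T∌δ u (T≐ u .from (u∈k , w≺u)))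

  kernel-above-absorbs : ∀ {x y w k T} → IsKernelOf D (Icc x y) k → w ∈ k → IsSlice k (w ≺_) T →
                         Absorbs D (λ z → z ≡ w ⊎ z ∈ T) (Ioc w y)
  kernel-above-absorbs {w = w} {k} {T} (k⊆xy , ind , ab) w∈k T≐ z (w≺z , z≤y) with z ∈? k
  ... | yes z∈k = inj₁ (inj₂ (T≐ z .from (z∈k , w≺z)))
  ... | no z∉k with ab z (ℚ.≤-trans (proj₁ (k⊆xy w w∈k)) (ℚ.<⇒≤ w≺z) , z≤y) z∉k
  ...   | u , u∈k , z→u = inj₂ (u , target , z→u)
    where
    target : u ≡ w ⊎ u ∈ T
    target with u ≟ᶠ w | f w ℚ.<? f u
    ... | yes u≡w | _ = inj₁ u≡w
    ... | no _ | yes w≺u = inj₂ (T≐ u .from (u∈k , w≺u))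
    ... | no u≢w | no w⊀u = contradiction
      (proj₁ (proj₂ (edge-over-non-edge (inj₂ z→u) (ind u w u∈k w∈k)
                       (Independent-≤⇒≺ ind u∈k w∈k (ℚ.≮⇒≥ w⊀u) u≢w) ℚ.≤-refl (ℚ.<⇒≤ w≺z))))
      (ℚ.<⇒≢ w≺z ∘ sym)

  highest-below : ∀ {x y c k T} → IsKernelOf D (Icc x y) k → x ∈ k →
                  IsSlice k (λ u → f c ≤ f u) T →
                  ¬ Absorbs D (λ z → z ≡ x ⊎ z ∈ T) (Icc x y) →
                  ∃[ w ] (w ∈ k × Ioo x c w × IsSlice k (w ≺_) T)
  highest-below {x} {c = c} {k} {T} ker@(k⊆xy , ind , _) x∈k T≐ ¬abs
    with argmax f (λ u → (u ∈? k) ×-dec ((f x ℚ.<? f u) ×-dec (f u ℚ.<? f c)))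
  ... | inj₁ none = contradiction (Absorbs-mono classify (kernel-absorbs ker)) ¬abs
    where
    classify : ∀ {u} → u ∈ k → u ≡ x ⊎ u ∈ T
    classify {u} u∈k with f c ℚ.≤? f u | f x ℚ.<? f u
    ... | yes c≤u | _ = inj₂ (T≐ u .from (u∈k , c≤u))
    ... | no c≰u | yes x≺u = contradiction (u∈k , x≺u , ℚ.≰⇒> c≰u) (none u)
    ... | no _ | no x⊀u =
      inj₁ (Independent-f-injective ind u∈k x∈k (ℚ.≤-antisym (ℚ.≮⇒≥ x⊀u) (proj₁ (k⊆xy u u∈k))))
  ... | inj₂ (w , (w∈k , x≺w , w≺c) , highest) = w , w∈k , (x≺w , w≺c) , above
    where
    c≤ : ∀ {u} → u ∈ k → w ≺ u → f c ≤ f u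
    c≤ {u} u∈k w≺u with f c ℚ.≤? f u
    ... | yes c≤u = c≤u
    ... | no c≰u = contradiction (highest u (u∈k , ℚ.<-trans x≺w w≺u , ℚ.≰⇒> c≰u)) (<⇒≱ w≺u)
    above : IsSlice k (w ≺_) T
    above u = mk⇔ (Product.map₂ (ℚ.<-≤-trans w≺c) ∘ T≐ u .to)
                  (λ (u∈k , w≺u) → T≐ u .from (u∈k , c≤ u∈k w≺u))

  kernel-split : ∀ {x y c k T} → K x y k → IsSlice k (λ u → f c ≤ f u) T →
                 ¬ Absorbs D (λ z → z ≡ x ⊎ z ∈ T) (Icc x y) →
                 (∀ w → w ∈ k → w ≺ c → ∀ t → t ∈ T → ¬ δ t w) →
                 ∃[ w ] (w ∈ k × Ioo x c w × K x w (k ∩ ∁ T)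
                         × Absorbs D (λ z → z ≡ w ⊎ z ∈ T) (Ioc w y) × k ≡ (k ∩ ∁ T) ∪ T)
  kernel-split {x} (ker , x∈k , _) T≐ ¬abs T∌δ with highest-below ker x∈k T≐ ¬abs
  ... | w , w∈k , (x≺w , w≺c) , above =
      w , w∈k , (x≺w , w≺c)
    , ( kernel-below ker w∈k above (T∌δ w w∈k w≺c)
      , slice-below above x .from (x∈k , ℚ.<⇒≤ x≺w)
      , slice-below above w .from (w∈k , ℚ.≤-refl) )
    , kernel-above-absorbs ker w∈k above
    , sym (p∩∁q∪q≡p (λ {u} → proj₁ ∘ T≐ u .to))

  kernel-join : ∀ {x y w k′ T} → K x w k′ → (∀ t → t ∈ T → Ioc w y t) → y ∈ T →
                Independent T → Absorbs D (λ z → z ≡ w ⊎ z ∈ T) (Ioc w y) →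
                (∀ u t → u ∈ k′ → t ∈ T → ¬ Adj D u t) → K x y (k′ ∪ T)
  kernel-join {x} {y} {w} {k′} {T} ((k′⊆xw , ind′ , ab′) , x∈k′ , w∈k′) T⊆wy y∈T ind-T ab-T apart =
    (sub , Independent-∪ ind′ ind-T apart , ab) , x∈p∪q⁺ (inj₁ x∈k′) , x∈p∪q⁺ (inj₂ y∈T)
    where
    w≺y : w ≺ y
    w≺y = proj₁ (T⊆wy y y∈T)
    sub : ∀ u → u ∈ k′ ∪ T → Icc x y u
    sub u u∈ with x∈p∪q⁻ k′ T u∈
    ... | inj₁ u∈k′ = proj₁ (k′⊆xw u u∈k′) , ℚ.≤-trans (proj₂ (k′⊆xw u u∈k′)) (ℚ.<⇒≤ w≺y)
    ... | inj₂ u∈T = ℚ.≤-trans (proj₁ (k′⊆xw w w∈k′)) (ℚ.<⇒≤ (proj₁ (T⊆wy u u∈T)))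
                   , proj₂ (T⊆wy u u∈T)
    ab : ∀ z → Icc x y z → z ∉ k′ ∪ T → ∃[ u ] (u ∈ k′ ∪ T × Arc D z u)
    ab z (x≤z , z≤y) z∉ with f w ℚ.<? f z
    ... | no w⊀z = Product.map₂ (Product.map₁ (x∈p∪q⁺ ∘ inj₁))
                                (ab′ z (x≤z , ℚ.≮⇒≥ w⊀z) (z∉ ∘ x∈p∪q⁺ ∘ inj₁))
    ... | yes w≺z with ab-T z (w≺z , z≤y)
    ...   | inj₁ (inj₁ refl) = contradiction w≺z (ℚ.<-irrefl refl)
    ...   | inj₁ (inj₂ z∈T) = contradiction (x∈p∪q⁺ (inj₂ z∈T)) z∉
    ...   | inj₂ (u , inj₁ refl , z→u) = u , x∈p∪q⁺ (inj₁ w∈k′) , z→u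
    ...   | inj₂ (u , inj₂ u∈T , z→u) = u , x∈p∪q⁺ (inj₂ u∈T) , z→u

  join-disjoint : ∀ {x y w k′ T} → K x w k′ → (∀ t → t ∈ T → Ioc w y t) → ∀ t → t ∈ T → t ∉ k′
  join-disjoint ((k′⊆xw , _) , _) T⊆wy t t∈T t∈k′ = <⇒≱ (proj₁ (T⊆wy t t∈T)) (proj₂ (k′⊆xw t t∈k′))

  join-injective : ∀ {x y w w′ k₁ k₂ T} → (∀ t → t ∈ T → Ioc w y t) → (∀ t → t ∈ T → Ioc w′ y t) →
                   K x w k₁ → K x w′ k₂ → k₁ ∪ T ≡ k₂ ∪ T → w ≡ w′
  join-injective T⊆wy T⊆w′y ((k₁⊆ , _) , _ , w∈k₁) ((k₂⊆ , ind₂ , _) , _ , w′∈k₂) eq =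
    Independent-f-injective ind₂ w∈k₂ w′∈k₂
      (ℚ.≤-antisym (proj₂ (k₂⊆ _ w∈k₂)) (proj₂ (k₁⊆ _ w′∈k₁)))
    where
    w∈k₂ = ∈-∪-cancelʳ (λ w∈T → ℚ.<-irrefl refl (proj₁ (T⊆wy _ w∈T))) w∈k₁ eq
    w′∈k₁ = ∈-∪-cancelʳ (λ w′∈T → ℚ.<-irrefl refl (proj₁ (T⊆w′y _ w′∈T))) w′∈k₂ (sym eq)

  ⁅⁆-⊆-Ioc : ∀ {w y} → w ≺ y → ∀ t → t ∈ ⁅ y ⁆ → Ioc w y t
  ⁅⁆-⊆-Ioc {y = y} w≺y t t∈ rewrite x∈⁅y⁆⇒x≡y y t∈ = w≺y , ℚ.≤-refl

  pair-⊆-Ioc : ∀ {w m y} → w ≺ m → m ≺ y → ∀ t → t ∈ ⁅ m ⁆ ∪ ⁅ y ⁆ → Ioc w y t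
  pair-⊆-Ioc w≺m m≺y t t∈ with ∈-pair⁻ t∈
  ... | inj₁ refl = w≺m , ℚ.<⇒≤ m≺y
  ... | inj₂ refl = ℚ.<-trans w≺m m≺y , ℚ.≤-refl

  K-by-δ : ∀ {x y k} → K x y k → K₀∅ x y k ⊎ ∃[ m ] (M x y m × K₀ x m y k)
  K-by-δ {x} {y} {k} Kk@((_ , ind , _) , x∈k , y∈k) with any? (λ m → (m ∈? k) ×-dec δ? y m)
  ... | yes (m , m∈k , δm) = inj₂ (m , (δm , [ ind m x m∈k x∈k , ind m y m∈k y∈k ]) , Kk , m∈k)
  ... | no none = inj₁ (Kk , λ m δm m∈k → none (m , m∈k , δm))

  K₀-unique : ∀ {x y k m m′} → M x y m → M x y m′ → K₀ x m y k → K₀ x m′ y k → m ≡ m′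
  K₀-unique (δm , _) (δm′ , _) (((_ , ind , _) , _) , m∈k) (_ , m′∈k) =
    Independent-f-injective ind m∈k m′∈k (δ-functional δm δm′)

  K-absorbing : ∀ {x y} → x ≺ y → ¬ Adj D x y → Absorbs D (set2 x y) (Icc x y) →
                ∀ k → K x y k ⇔ (k ≡ ⁅ x ⁆ ∪ ⁅ y ⁆)
  K-absorbing {x} {y} x≺y x≁y abs k =
    ⇔-trans K⇔ (kernel-unique-if-absorbing A⊆xy (Independent-pair x≁y) (Absorbs-mono ∈-pair⁺ abs) k)
    where
    K⇔ : K x y k ⇔ (IsKernelOf D (Icc x y) k × ⁅ x ⁆ ∪ ⁅ y ⁆ ⊆ k)
    K⇔ = mk⇔ (λ (ker , x∈k , y∈k) → ker , ∪⊆ (⁅⁆⊆ x∈k) (⁅⁆⊆ y∈k))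
             (λ (ker , A⊆k) → ker , A⊆k (∈-pair⁺ (inj₁ refl)) , A⊆k (∈-pair⁺ (inj₂ refl)))
    A⊆xy : ∀ u → u ∈ ⁅ x ⁆ ∪ ⁅ y ⁆ → Icc x y u
    A⊆xy u u∈ with ∈-pair⁻ u∈
    ... | inj₁ refl = ℚ.≤-refl , ℚ.<⇒≤ x≺y
    ... | inj₂ refl = ℚ.<⇒≤ x≺y , ℚ.≤-refl

  ⁅y⁆-top-slice : ∀ {x y k} → K x y k → IsSlice k (λ u → f y ≤ f u) ⁅ y ⁆
  ⁅y⁆-top-slice {y = y} {k} ((k⊆xy , ind , _) , _ , y∈k) u = mk⇔ top⁻ top⁺
    where
    top⁻ : u ∈ ⁅ y ⁆ → u ∈ k × f y ≤ f u
    top⁻ u∈ rewrite x∈⁅y⁆⇒x≡y y u∈ = y∈k , ℚ.≤-refl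
    top⁺ : u ∈ k × f y ≤ f u → u ∈ ⁅ y ⁆
    top⁺ (u∈k , y≤u) =
      ≡⇒∈⁅⁆ (Independent-f-injective ind u∈k y∈k (ℚ.≤-antisym (proj₂ (k⊆xy u u∈k)) y≤u))

  K₀∅-split : ∀ {x y k} → ¬ Absorbs D (set2 x y) (Icc x y) → K₀∅ x y k →
              ∃[ w ] ∃[ k′ ] (Λ x y w × K x w k′ × k ≡ k′ ∪ ⁅ y ⁆)
  K₀∅-split {x} {y} ¬abs (Kk@((_ , ind , _) , x∈k , y∈k) , k∌δ)
    with kernel-split Kk (⁅y⁆-top-slice Kk) (¬abs ∘ Absorbs-mono (Sum.map₂ (x∈⁅y⁆⇒x≡y y)))
           (λ w w∈k _ t t∈ → subst (λ t → ¬ δ t w) (sym (x∈⁅y⁆⇒x≡y y t∈)) (λ δw → k∌δ w δw w∈k))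
  ... | w , w∈k , x≺w≺y , Kw , abs , k≡ =
    w , _ , ( x≺w≺y , [ ind w x w∈k x∈k , ind w y w∈k y∈k ] , (λ δw → k∌δ w δw w∈k)
            , Absorbs-mono (Sum.map₂ (x∈⁅y⁆⇒x≡y y)) abs )
      , Kw , k≡

  Λ-⊆-Ioc : ∀ {x y w} → Λ x y w → ∀ t → t ∈ ⁅ y ⁆ → Ioc w y t
  Λ-⊆-Ioc ((_ , w≺y) , _) = ⁅⁆-⊆-Ioc w≺y

  K₀∅-join : ∀ {x y k} → ∃[ w ] ∃[ k′ ] (Λ x y w × K x w k′ × k ≡ k′ ∪ ⁅ y ⁆) → K₀∅ x y k
  K₀∅-join {y = y} (w , k′ , Λw@((_ , w≺y) , w≁xy , ¬δw , abs) , Kw@((k′⊆xw , _) , _) , refl) =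
      kernel-join Kw (Λ-⊆-Ioc Λw) (x∈⁅x⁆ y) (Independent-⁅⁆ y) (Absorbs-mono (Sum.map₂ ≡⇒∈⁅⁆) abs) apart
    , k∌δ
    where
    w≁y : ¬ Adj D w y
    w≁y = w≁xy ∘ inj₂
    apart : ∀ u t → u ∈ k′ → t ∈ ⁅ y ⁆ → ¬ Adj D u t
    apart u t u∈k′ t∈ rewrite x∈⁅y⁆⇒x≡y y t∈ = λ u~y →
      ¬δw (proj₂ (proj₂ (edge-over-non-edge u~y w≁y w≺y (proj₂ (k′⊆xw u u∈k′)) ℚ.≤-refl)))
    k∌δ : ∀ m → δ y m → m ∉ k′ ∪ ⁅ y ⁆
    k∌δ m δm m∈ with x∈p∪q⁻ k′ ⁅ y ⁆ m∈
    ... | inj₁ m∈k′ = ¬δw (δ-resp-f (sym (non-neighbour-in-δ δm (proj₂ (k′⊆xw m m∈k′)) w≺y w≁y)) δm)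
    ... | inj₂ m∈⁅y⁆ = ≺⇒≢ (δ⇒≺ δm) (x∈⁅y⁆⇒x≡y y m∈⁅y⁆)

  pair-top-slice : ∀ {x y m k} → δ y m → K x y k → m ∈ k →
                   IsSlice k (λ u → f m ≤ f u) (⁅ m ⁆ ∪ ⁅ y ⁆)
  pair-top-slice {y = y} {m} {k} δm ((k⊆xy , ind , _) , _ , y∈k) m∈k u = mk⇔ top⁻ top⁺
    where
    top⁻ : ∀ {u} → u ∈ ⁅ m ⁆ ∪ ⁅ y ⁆ → u ∈ k × f m ≤ f u
    top⁻ u∈ with ∈-pair⁻ u∈
    ... | inj₁ refl = m∈k , ℚ.≤-refl
    ... | inj₂ refl = y∈k , ℚ.<⇒≤ (δ⇒≺ δm)
    top⁺ : u ∈ k × f m ≤ f u → u ∈ ⁅ m ⁆ ∪ ⁅ y ⁆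
    top⁺ (u∈k , m≤u) with u ≟ᶠ y
    ... | yes u≡y = ∈-pair⁺ (inj₂ u≡y)
    ... | no u≢y = ∈-pair⁺ (inj₁ (Independent-f-injective ind u∈k m∈k (non-neighbour-in-δ δm m≤u
                     (Independent-≤⇒≺ ind u∈k y∈k (proj₂ (k⊆xy u u∈k)) u≢y) (ind u y u∈k y∈k))))

  pair-∌δ : ∀ {y m w} → δ y m → w ≺ m → ∀ t → t ∈ ⁅ m ⁆ ∪ ⁅ y ⁆ → ¬ δ t w
  pair-∌δ δm w≺m t t∈ with ∈-pair⁻ t∈
  ... | inj₁ refl = δ-unchained δm
  ... | inj₂ refl = λ δw → ℚ.<⇒≢ w≺m (δ-functional δw δm)

  K₀-split : ∀ {x y m k} → M x y m → ¬ Absorbs D (set3 x m y) (Icc x y) → K₀ x m y k →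
             ∃[ w ] ∃[ k′ ] (Λ' x m y w × K x w k′ × k ≡ k′ ∪ (⁅ m ⁆ ∪ ⁅ y ⁆))
  K₀-split {x} {m = m} (δm , _) ¬abs (Kk@((_ , ind , _) , x∈k , _) , m∈k)
    with kernel-split Kk (pair-top-slice δm Kk m∈k) (¬abs ∘ Absorbs-mono (Sum.map₂ ∈-pair⁻))
           (λ w _ w≺m → pair-∌δ δm w≺m)
  ... | w , w∈k , x≺w≺m , Kw , abs , k≡ =
    w , _ , (x≺w≺m , [ ind w x w∈k x∈k , ind w m w∈k m∈k ] , Absorbs-mono (Sum.map₂ ∈-pair⁻) abs)
      , Kw , k≡

  Λ'-⊆-Ioc : ∀ {x y m w} → M x y m → Λ' x m y w → ∀ t → t ∈ ⁅ m ⁆ ∪ ⁅ y ⁆ → Ioc w y t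
  Λ'-⊆-Ioc (δm , _) ((_ , w≺m) , _) = pair-⊆-Ioc w≺m (δ⇒≺ δm)

  K₀-join : ∀ {x y m k} → M x y m →
            ∃[ w ] ∃[ k′ ] (Λ' x m y w × K x w k′ × k ≡ k′ ∪ (⁅ m ⁆ ∪ ⁅ y ⁆)) → K₀ x m y k
  K₀-join {y = y} {m} Mm@(δm , m≁xy)
          (w , k′ , Λw@((_ , w≺m) , w≁xm , abs) , Kw@((k′⊆xw , _) , _) , refl) =
      kernel-join Kw (Λ'-⊆-Ioc Mm Λw) (∈-pair⁺ (inj₂ refl)) (Independent-pair (m≁xy ∘ inj₂))
                  (Absorbs-mono (Sum.map₂ ∈-pair⁺) abs) apart
    , x∈p∪q⁺ (inj₂ (∈-pair⁺ (inj₁ refl)))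
    where
    apart : ∀ u t → u ∈ k′ → t ∈ ⁅ m ⁆ ∪ ⁅ y ⁆ → ¬ Adj D u t
    apart u t u∈k′ t∈ with ∈-pair⁻ t∈ | proj₂ (k′⊆xw u u∈k′)
    ... | inj₁ refl | u≤w = λ u~m → δ-unchained δm
      (proj₂ (proj₂ (edge-over-non-edge u~m (w≁xm ∘ inj₂) w≺m u≤w ℚ.≤-refl)))
    ... | inj₂ refl | u≤w = λ u~y → ℚ.<⇒≢ (ℚ.≤-<-trans u≤w w≺m)
      (proj₁ (edge-over-non-edge u~y (m≁xy ∘ inj₂) (δ⇒≺ δm) (ℚ.≤-trans u≤w (ℚ.<⇒≤ w≺m)) ℚ.≤-refl))

  K₀-absorbing : ∀ {x y m} → x ≺ y → ¬ Adj D x y → M x y m → Absorbs D (set3 x m y) (Icc x y) →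
                 ∀ k → K₀ x m y k ⇔ (k ≡ ⁅ x ⁆ ∪ (⁅ m ⁆ ∪ ⁅ y ⁆))
  K₀-absorbing {x} {y} {m} x≺y x≁y (δm , m≁xy) abs k =
    ⇔-trans K₀⇔ (kernel-unique-if-absorbing A⊆xy ind-A (Absorbs-mono ∈-triple⁺ abs) k)
    where
    A : Subset n
    A = ⁅ x ⁆ ∪ (⁅ m ⁆ ∪ ⁅ y ⁆)
    K₀⇔ : K₀ x m y k ⇔ (IsKernelOf D (Icc x y) k × A ⊆ k)
    K₀⇔ = mk⇔ (λ ((ker , x∈k , y∈k) , m∈k) → ker , ∪⊆ (⁅⁆⊆ x∈k) (∪⊆ (⁅⁆⊆ m∈k) (⁅⁆⊆ y∈k)))
              (λ (ker , A⊆k) → ( ker , A⊆k (∈-triple⁺ (inj₁ refl))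
                               , A⊆k (∈-triple⁺ (inj₂ (inj₂ refl))) )
                             , A⊆k (∈-triple⁺ (inj₂ (inj₁ refl))))
    A⊆xy : ∀ u → u ∈ A → Icc x y u
    A⊆xy u u∈ with ∈-triple⁻ u∈
    ... | inj₁ refl = ℚ.≤-refl , ℚ.<⇒≤ x≺y
    ... | inj₂ (inj₁ refl) = δ-above-non-neighbour δm x≺y x≁y , ℚ.<⇒≤ (δ⇒≺ δm)
    ... | inj₂ (inj₂ refl) = ℚ.<⇒≤ x≺y , ℚ.≤-refl
    ind-A : Independent A
    ind-A = Independent-∪ (Independent-⁅⁆ x) (Independent-pair (m≁xy ∘ inj₂)) apart
      where
      apart : ∀ u v → u ∈ ⁅ x ⁆ → v ∈ ⁅ m ⁆ ∪ ⁅ y ⁆ → ¬ Adj D u v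
      apart u v u∈ v∈ rewrite x∈⁅y⁆⇒x≡y x u∈ with ∈-pair⁻ v∈
      ... | inj₁ refl = m≁xy ∘ inj₁ ∘ Adj-sym
      ... | inj₂ refl = x≁y

lemma10 : ∀ {n : ℕ} (D : Digraph n) (f : Fin n → ℚ) (𝓘 : List Interval) →
    IsNiceModel D f 𝓘 →
    let open Notation D f 𝓘 in
    ∀ (x y : Fin n) → x ≺ y → ¬ Adj D x y →
    -- case: {x,y} does not absorb [x;y]
    ( ¬ Absorbs D (set2 x y) (Icc x y) →
      -- K(x,y) = ⨆_{m ∈ (δ(y) ∖ N({x,y})) ⊔ {∅}} K₀(x,m,y)
      ( (∀ k → K x y k ⇔ (K₀∅ x y k ⊎ ∃[ m ] (M x y m × K₀ x m y k)))
      × (∀ k m → M x y m → K₀∅ x y k → ¬ K₀ x m y k)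
      × (∀ k m m′ → M x y m → M x y m′ → K₀ x m y k → K₀ x m′ y k → m ≡ m′) )
      -- K₀(x,∅,y) = ⨆_{w ∈ Λ(x,y)} { k ⊔ {y} : k ∈ K(x,w) }
    × ( (∀ k → K₀∅ x y k ⇔ (∃[ w ] ∃[ k′ ] (Λ x y w × K x w k′ × k ≡ k′ ∪ ⁅ y ⁆)))
      × (∀ w k′ → Λ x y w → K x w k′ → y ∉ k′)
      × (∀ w w′ k₁ k₂ → Λ x y w → Λ x y w′ → K x w k₁ → K x w′ k₂ →
           k₁ ∪ ⁅ y ⁆ ≡ k₂ ∪ ⁅ y ⁆ → w ≡ w′) )
      -- for every m ∈ δ(y) ∖ N({x,y})
    × (∀ m → M x y m →
        ( Absorbs D (set3 x m y) (Icc x y) →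
            ∀ k → K₀ x m y k ⇔ (k ≡ ⁅ x ⁆ ∪ (⁅ m ⁆ ∪ ⁅ y ⁆)) )
      × ( ¬ Absorbs D (set3 x m y) (Icc x y) →
            (∀ k → K₀ x m y k ⇔
                 (∃[ w ] ∃[ k′ ] (Λ' x m y w × K x w k′ × k ≡ k′ ∪ (⁅ m ⁆ ∪ ⁅ y ⁆))))
          × (∀ w k′ → Λ' x m y w → K x w k′ → (m ∉ k′ × y ∉ k′))
          × (∀ w w′ k₁ k₂ → Λ' x m y w → Λ' x m y w′ → K x w k₁ → K x w′ k₂ →
               k₁ ∪ (⁅ m ⁆ ∪ ⁅ y ⁆) ≡ k₂ ∪ (⁅ m ⁆ ∪ ⁅ y ⁆) → w ≡ w′) ) ) )
    -- case: {x,y} absorbs [x;y]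
    × ( Absorbs D (set2 x y) (Icc x y) →
          ∀ k → K x y k ⇔ (k ≡ ⁅ x ⁆ ∪ ⁅ y ⁆) )
lemma10 D f 𝓘 nice x y x≺y x≁y =
    (λ ¬abs →
        ( (λ k → mk⇔ K-by-δ λ { (inj₁ (Kk , _)) → Kk ; (inj₂ (_ , _ , Kk , _)) → Kk })
        , (λ k m (δm , _) (_ , k∌δ) (_ , m∈k) → k∌δ m δm m∈k)
        , (λ k m m′ → K₀-unique) )
      , ( (λ k → mk⇔ (K₀∅-split ¬abs) K₀∅-join)
        , (λ w k′ Λw Kw → join-disjoint Kw (Λ-⊆-Ioc Λw) y (x∈⁅x⁆ y))
        , (λ w w′ k₁ k₂ Λw Λw′ → join-injective (Λ-⊆-Ioc Λw) (Λ-⊆-Ioc Λw′)) )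
      , λ m Mm →
          K₀-absorbing x≺y x≁y Mm
        , λ ¬abs₃ →
            (λ k → mk⇔ (K₀-split Mm ¬abs₃) (K₀-join Mm))
          , (λ w k′ Λw Kw → join-disjoint Kw (Λ'-⊆-Ioc Mm Λw) m (∈-pair⁺ (inj₁ refl))
                          , join-disjoint Kw (Λ'-⊆-Ioc Mm Λw) y (∈-pair⁺ (inj₂ refl)))
          , (λ w w′ k₁ k₂ Λw Λw′ → join-injective (Λ'-⊆-Ioc Mm Λw) (Λ'-⊆-Ioc Mm Λw′)))
  , K-absorbing x≺y x≁y
  where
  open NiceModel nice
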